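{- If a connected graph $G$ satisfies $\chi_{\text{lid}}(G)\leq 3$, then $G$ is either a triangle or a bipartite graph.
   Context: For a vertex $u$, $N[u]$ is its closed neighborhood; for a coloring $c$ and vertex set $S$, $c(S)$ is the set of colors on $S$. A lid-coloring is a proper vertex-coloring $c$ such that for every edge $uv$ with $N[u]\neq N[v]$, $c(N[u])\neq c(N[v])$; $\chi_{\text{lid}}(G)$ is the minimum number of colors in a lid-coloring of $G$. -}

module Defs where

open import Data.Nat using (ℕ)
open import Data.Fin using (Fin)
open import Data.Bool using (Bool; true; false)
open import Data.Product using (Σ; _×_; ∃; ∃-syntax; _,_)
open import Data.Sum using (_⊎_)
open import Relation.Nullary using (¬_)
open import Relation.Binary.PropositionalEquality using (_≡_; _≢_)

record Graph : Set where
  field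
    n     : ℕ
    adj   : Fin n → Fin n → Bool
    sym   : ∀ u v → adj u v ≡ adj v u
    irrefl : ∀ u → adj u u ≡ false

open Graph public

Vertex : Graph → Set
Vertex G = Fin (n G)

Adj : (G : Graph) → Vertex G → Vertex G → Set
Adj G u v = adj G u v ≡ true

data Walk (G : Graph) : Vertex G → Vertex G → Set where
  nil  : ∀ {u} → Walk G u u
  cons : ∀ {u v w} → Adj G u v → Walk G v w → Walk G u w

Connected : Graph → Set
Connected G = ∀ (u v : Vertex G) → Walk G u v

_∈N[_] : {G : Graph} → Vertex G → Vertex G → Set
_∈N[_] {G} w u = (w ≡ u) ⊎ Adj G u w

SameClosedNbhd : (G : Graph) → Vertex G → Vertex G → Set
SameClosedNbhd G u v = ∀ (w : Vertex G) → ((_∈N[_] {G} w u → _∈N[_] {G} w v) × (_∈N[_] {G} w v → _∈N[_] {G} w u))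

ColorIn : (G : Graph) {k : ℕ} → (Vertex G → Fin k) → Fin k → Vertex G → Set
ColorIn G c i u = ∃[ w ] (_∈N[_] {G} w u × c w ≡ i)

SameColorSet : (G : Graph) {k : ℕ} → (Vertex G → Fin k) → Vertex G → Vertex G → Set
SameColorSet G {k} c u v = ∀ (i : Fin k) → ((ColorIn G c i u → ColorIn G c i v) × (ColorIn G c i v → ColorIn G c i u))

Proper : (G : Graph) {k : ℕ} → (Vertex G → Fin k) → Set
Proper G c = ∀ u v → Adj G u v → c u ≢ c v

IsLidColoring : (G : Graph) {k : ℕ} → (Vertex G → Fin k) → Set
IsLidColoring G c = Proper G c × (∀ u v → Adj G u v → ¬ SameClosedNbhd G u v → ¬ SameColorSet G c u v)

LidChromaticAtMost : Graph → ℕ → Set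
LidChromaticAtMost G k = ∃[ c ] IsLidColoring G {k} c

IsTriangle : Graph → Set
IsTriangle G = (n G ≡ 3) × (∀ u v → u ≢ v → Adj G u v)

Bipartite : Graph → Set
Bipartite G = Σ (Vertex G → Bool) λ f → (∀ (u v : Vertex G) → Adj G u v → f u ≢ f v)

module Submission where

-- Let c be a lid-colouring of a connected graph G with the three colours
-- Fin 3, and call a vertex x full when c(N[x]) contains all three colours.
-- If x is not full and xy is an edge, then c(N[x]) = {c x, c y}; hence the
-- endpoints of an edge with the same fullness status have the same colour
-- set, and the lid condition forces them to be twins (N[x] = N[y]).  So
-- either fullness is a bipartition of G, or G has a twin edge uv.  If u has
-- a neighbour w other than v, then uvw is a triangle; its vertices are full,
-- hence pairwise twins, and no vertex is adjacent to all of them (it would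
-- need a fourth colour), so the triangle contains the closed neighbourhoods
-- of its vertices and by connectivity G = K₃.  Otherwise the same reasoning
-- with N[u] = N[v] = {u, v} gives G = K₂, which is bipartite.

open import Defs
open import Data.Bool using (Bool; true) renaming (_≟_ to _≟B_)
open import Data.Fin using (Fin; punchOut; _≟_)
open import Data.Fin.Patterns using (0F; 1F; 2F)
open import Data.Fin.Properties using (punchOut-injective; any?; all?; ¬∀⟶∃¬; injective⇒≤; 2↔Bool)
open import Data.Nat using (suc)
open import Data.Nat.Properties using (≤-antisym)
open import Data.Product using (Σ; _×_; ∃-syntax; ∃₂; _,_; proj₁; proj₂)
open import Data.Sum using (_⊎_; inj₁; inj₂; [_,_]′)
import Data.Sum as Sum
open import Data.Empty using (⊥-elim)
open import Function using (id)
open import Function.Bundles using (Injection)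
open import Function.Properties.Inverse using (↔⇒↣)
open import Relation.Nullary using (¬_; Dec; yes; no)
open import Relation.Nullary.Decidable using (_×-dec_; _⊎-dec_; _→-dec_; ¬?; isYes; decidable-stable)
open import Relation.Binary.PropositionalEquality using (_≡_; _≢_; refl; trans; cong; subst; ≢-sym) renaming (sym to ≡-sym)

avoidingSame₂ : {x y z : Fin 2} → x ≢ z → y ≢ z → x ≡ y
avoidingSame₂ {0F} {0F} _ _ = refl
avoidingSame₂ {1F} {1F} _ _ = refl
avoidingSame₂ {0F} {1F} {0F} x≢z _ = ⊥-elim (x≢z refl)
avoidingSame₂ {0F} {1F} {1F} _ y≢z = ⊥-elim (y≢z refl)
avoidingSame₂ {1F} {0F} {0F} _ y≢z = ⊥-elim (y≢z refl)
avoidingSame₂ {1F} {0F} {1F} x≢z _ = ⊥-elim (x≢z refl)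

-- Given two distinct colours a, b out of three, there is only one colour
-- avoiding both.  Deleting a from Fin 3 (punchOut) reduces this to Fin 2.
thirdColour : {a b i j : Fin 3} → a ≢ b → i ≢ a → i ≢ b → j ≢ a → j ≢ b → i ≡ j
thirdColour {a} {b} a≢b i≢a i≢b j≢a j≢b =
  punchOut-injective (≢-sym i≢a) (≢-sym j≢a)
    (avoidingSame₂ (punchOut-avoids-b i≢a i≢b) (punchOut-avoids-b j≢a j≢b))
  where
  punchOut-avoids-b : ∀ {k} (k≢a : k ≢ a) → k ≢ b → punchOut (≢-sym k≢a) ≢ punchOut a≢b
  punchOut-avoids-b k≢a k≢b eq = k≢b (punchOut-injective (≢-sym k≢a) a≢b eq)

module GraphFacts (G : Graph) where

  _∈N_ : Vertex G → Vertex G → Set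
  w ∈N x = _∈N[_] {G} w x

  adjSym : ∀ {x y} → Adj G x y → Adj G y x
  adjSym {x} {y} e = trans (sym G y x) e

  adjIrrefl : ∀ {x} → ¬ Adj G x x
  adjIrrefl {x} e with () ← trans (≡-sym e) (irrefl G x)

  ∈N-distinct : ∀ {w x} → w ∈N x → w ≢ x → Adj G x w
  ∈N-distinct (inj₁ w≡x) w≢x = ⊥-elim (w≢x w≡x)
  ∈N-distinct (inj₂ e)   _   = e

  adj? : ∀ x y → Dec (Adj G x y)
  adj? x y = adj G x y ≟B true

  ∈N? : ∀ w x → Dec (w ∈N x)
  ∈N? w x = (w ≟ x) ⊎-dec adj? x w

  sameClosedNbhd? : ∀ x y → Dec (SameClosedNbhd G x y)
  sameClosedNbhd? x y = all? λ w → (∈N? w x →-dec ∈N? w y) ×-dec (∈N? w y →-dec ∈N? w x)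

  bipartiteOrMonochromaticEdge : (f : Vertex G → Bool) → Bipartite G ⊎ ∃₂ λ x y → Adj G x y × f x ≡ f y
  bipartiteOrMonochromaticEdge f with any? (λ x → any? λ y → adj? x y ×-dec (f x ≟B f y))
  ... | yes (x , y , e , same) = inj₂ (x , y , e , same)
  ... | no none = inj₁ (f , λ x y e same → none (x , y , e , same))

  IsClique : ∀ {k} → (Fin k → Vertex G) → Set
  IsClique t = ∀ i j → i ≢ j → Adj G (t i) (t j)

  Spans : ∀ {k} → (Fin k → Vertex G) → Set
  Spans t = ∀ x → ∃[ i ] t i ≡ x

  index-injective : ∀ {k} {t : Fin k → Vertex G} (spans : Spans t) {x y} →
                    proj₁ (spans x) ≡ proj₁ (spans y) → x ≡ y
  index-injective {t = t} spans {x} {y} eq =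
    trans (≡-sym (proj₂ (spans x))) (trans (cong t eq) (proj₂ (spans y)))

  clique-∈N : ∀ {k} {t : Fin k → Vertex G} → IsClique t → ∀ i j → t i ∈N t j
  clique-∈N clique i j with i ≟ j
  ... | yes refl = inj₁ refl
  ... | no i≢j = inj₂ (clique j i (≢-sym i≢j))

  spanningClique⇒complete : ∀ {k} {t : Fin k → Vertex G} → IsClique t → Spans t →
                            n G ≡ k × (∀ x y → x ≢ y → Adj G x y)
  spanningClique⇒complete {t = t} clique spans =
    ≤-antisym (injective⇒≤ (index-injective spans)) (injective⇒≤ t-injective) , complete
    where
    t-injective : ∀ {i j} → t i ≡ t j → i ≡ j
    t-injective {i} {j} eq with i ≟ j
    ... | yes i≡j = i≡j
    ... | no i≢j = ⊥-elim (adjIrrefl (subst (Adj G (t i)) (≡-sym eq) (clique i j i≢j)))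

    complete : ∀ x y → x ≢ y → Adj G x y
    complete x y x≢y with spans x | spans y
    ... | i , refl | j , refl = clique i j λ i≡j → x≢y (cong t i≡j)

  -- A graph listed by two vertices is bipartite: the side of x is its position.
  spannedByTwo⇒bipartite : {t : Fin 2 → Vertex G} → Spans t → Bipartite G
  spannedByTwo⇒bipartite spans = side , separates
    where
    open Injection (↔⇒↣ 2↔Bool) using (to; injective)

    side : Vertex G → Bool
    side x = to (proj₁ (spans x))

    separates : ∀ x y → Adj G x y → side x ≢ side y
    separates x y e same =
      adjIrrefl (subst (Adj G x) (≡-sym (index-injective spans (injective same))) e)

  nbhdClosed⇒spans : Connected G → ∀ {k} {t : Fin (suc k) → Vertex G} →
                     (∀ i {w} → w ∈N t i → ∃[ j ] t j ≡ w) → Spans t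
  nbhdClosed⇒spans conn {t = t} closed x = along (conn (t 0F) x) (0F , refl)
    where
    along : ∀ {y z} → Walk G y z → ∃[ i ] t i ≡ y → ∃[ j ] t j ≡ z
    along nil listed = listed
    along (cons e walk) (i , refl) = along walk (closed i (inj₂ e))

  pair : Vertex G → Vertex G → Fin 2 → Vertex G
  pair u v 0F = u
  pair u v 1F = v

  triple : Vertex G → Vertex G → Vertex G → Fin 3 → Vertex G
  triple u v w 0F = u
  triple u v w 1F = v
  triple u v w 2F = w

  triangle : ∀ {u v w} → Adj G u v → Adj G u w → Adj G v w → IsClique (triple u v w)
  triangle uv uw vw 0F 1F _ = uv
  triangle uv uw vw 0F 2F _ = uw
  triangle uv uw vw 1F 2F _ = vw
  triangle uv uw vw 1F 0F _ = adjSym uv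
  triangle uv uw vw 2F 0F _ = adjSym uw
  triangle uv uw vw 2F 1F _ = adjSym vw
  triangle uv uw vw 0F 0F 0≢0 = ⊥-elim (0≢0 refl)
  triangle uv uw vw 1F 1F 1≢1 = ⊥-elim (1≢1 refl)
  triangle uv uw vw 2F 2F 2≢2 = ⊥-elim (2≢2 refl)

  twinEdge⇒triangleOrK₂ : Connected G → ∀ {u v} → Adj G u v → SameClosedNbhd G u v →
                          Σ (Fin 3 → Vertex G) IsClique ⊎ Spans (pair u v)
  twinEdge⇒triangleOrK₂ conn {u} {v} uv twins with any? (λ w → adj? u w ×-dec ¬? (w ≟ v))
  ... | yes (w , uw , w≢v) = inj₁ (_ , triangle uv uw (∈N-distinct (proj₁ (twins w) (inj₂ uw)) w≢v))
  ... | no noThird = inj₂ (nbhdClosed⇒spans conn closed)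
    where
    inNu : ∀ {w} → w ∈N u → ∃[ i ] pair u v i ≡ w
    inNu (inj₁ refl) = 0F , refl
    inNu {w} (inj₂ uw) with w ≟ v
    ... | yes refl = 1F , refl
    ... | no w≢v = ⊥-elim (noThird (w , uw , w≢v))

    closed : ∀ i {w} → w ∈N pair u v i → ∃[ j ] pair u v j ≡ w
    closed 0F m = inNu m
    closed 1F {w} m = inNu (proj₂ (twins w) m)

module ThreeLidColouring (G : Graph) (c : Vertex G → Fin 3) (lidColouring : IsLidColoring G c) where
  open GraphFacts G

  private
    proper : Proper G c
    proper = proj₁ lidColouring

  Full : Vertex G → Set
  Full x = ∀ i → ColorIn G c i x

  colourIn? : ∀ i x → Dec (ColorIn G c i x)
  colourIn? i x = any? λ w → ∈N? w x ×-dec (c w ≟ i)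

  full? : ∀ x → Dec (Full x)
  full? x = all? λ i → colourIn? i x

  fullness : Vertex G → Bool
  fullness x = isYes (full? x)

  member-colour : ∀ {w x} → w ∈N x → ColorIn G c (c w) x
  member-colour m = _ , m , refl

  -- If x is not full and xy is an edge, then c(N[x]) ⊆ {c x, c y}: a third
  -- colour in N[x] would have to be the missing one.
  nonFull-colours : ∀ {x y} → Adj G x y → ¬ Full x → ∀ {i} → ColorIn G c i x → i ≡ c x ⊎ i ≡ c y
  nonFull-colours {x} {y} xy notFull {i} i∈ with ¬∀⟶∃¬ 3 _ (λ j → colourIn? j x) notFull | i ≟ c x | i ≟ c y
  ... | _ | yes i≡cx | _ = inj₁ i≡cx
  ... | _ | no _ | yes i≡cy = inj₂ i≡cy
  ... | j , j∉ | no i≢cx | no i≢cy =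
    ⊥-elim (j∉ (subst (λ k → ColorIn G c k x) i≡j i∈))
    where
    j-avoids : ∀ {w} → w ∈N x → j ≢ c w
    j-avoids m j≡cw = j∉ (subst (λ k → ColorIn G c k x) (≡-sym j≡cw) (member-colour m))

    i≡j : i ≡ j
    i≡j = thirdColour (proper x y xy) i≢cx i≢cy (j-avoids (inj₁ refl)) (j-avoids (inj₂ xy))

  sameFullness⇒sameColours : ∀ {x y} → Adj G x y → fullness x ≡ fullness y → SameColorSet G c x y
  sameFullness⇒sameColours {x} {y} xy same with full? x | full? y
  ... | yes fullX | yes fullY = λ i → (λ _ → fullY i) , (λ _ → fullX i)
  ... | no notFullX | no notFullY = λ i → toOther xy notFullX , toOther (adjSym xy) notFullY
    where
    toOther : ∀ {a b i} → Adj G a b → ¬ Full a → ColorIn G c i a → ColorIn G c i b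
    toOther ab notFull i∈ with nonFull-colours ab notFull i∈
    ... | inj₁ refl = member-colour (inj₂ (adjSym ab))
    ... | inj₂ refl = member-colour (inj₁ refl)
  sameFullness⇒sameColours _ () | yes _ | no _
  sameFullness⇒sameColours _ () | no _ | yes _

  sameColours⇒twins : ∀ {x y} → Adj G x y → SameColorSet G c x y → SameClosedNbhd G x y
  sameColours⇒twins {x} {y} xy same = decidable-stable (sameClosedNbhd? x y) λ notTwins → proj₂ lidColouring x y xy notTwins same

  triangle-colours : ∀ {t : Fin 3 → Vertex G} → IsClique t → ∀ i → ∃[ j ] c (t j) ≡ i
  triangle-colours {t} clique i with i ≟ c (t 0F) | i ≟ c (t 1F)
  ... | yes i≡c₀ | _ = 0F , ≡-sym i≡c₀
  ... | no _ | yes i≡c₁ = 1F , ≡-sym i≡c₁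
  ... | no i≢c₀ | no i≢c₁ =
    2F , ≡-sym (thirdColour (distinct 0F 1F λ ()) i≢c₀ i≢c₁ (distinct 2F 0F λ ()) (distinct 2F 1F λ ()))
    where
    distinct : ∀ j k → j ≢ k → c (t j) ≢ c (t k)
    distinct j k j≢k = proper (t j) (t k) (clique j k j≢k)

  no-K₄ : ∀ {t : Fin 3 → Vertex G} → IsClique t → ∀ b → ¬ (∀ j → Adj G (t j) b)
  no-K₄ clique b adjacentToAll with triangle-colours clique (c b)
  ... | j , cⱼ≡cb = proper _ _ (adjacentToAll j) cⱼ≡cb

  triangle-full : ∀ {t : Fin 3 → Vertex G} → IsClique t → ∀ k → Full (t k)
  triangle-full clique k i with triangle-colours clique i
  ... | j , refl = member-colour (clique-∈N clique j k)

  triangle-twins : ∀ {t : Fin 3 → Vertex G} → IsClique t → ∀ j → SameClosedNbhd G (t 0F) (t j)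
  triangle-twins clique j with j ≟ 0F
  ... | yes refl = λ w → id , id
  ... | no j≢0 = sameColours⇒twins (clique 0F j (≢-sym j≢0))
                   λ i → (λ _ → triangle-full clique j i) , (λ _ → triangle-full clique 0F i)

  -- In a connected graph, a triangle is the whole graph: a neighbour of one
  -- of its vertices is, by twinship, adjacent to all three unless it is one
  -- of them, which no-K₄ excludes.
  triangle-spans : Connected G → ∀ {t : Fin 3 → Vertex G} → IsClique t → Spans t
  triangle-spans conn {t} clique = nbhdClosed⇒spans conn closed
    where
    inN₀ : ∀ {w} → w ∈N t 0F → ∃[ j ] t j ≡ w
    inN₀ (inj₁ refl) = 0F , refl
    inN₀ {w} (inj₂ t₀w) with w ≟ t 1F | w ≟ t 2F
    ... | yes refl | _ = 1F , refl
    ... | no _ | yes refl = 2F , refl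
    ... | no w≢t₁ | no w≢t₂ = ⊥-elim (no-K₄ clique w adjacentToAll)
      where
      inN : ∀ j → w ∈N t j
      inN j = proj₁ (triangle-twins clique j w) (inj₂ t₀w)

      adjacentToAll : ∀ j → Adj G (t j) w
      adjacentToAll 0F = t₀w
      adjacentToAll 1F = ∈N-distinct (inN 1F) w≢t₁
      adjacentToAll 2F = ∈N-distinct (inN 2F) w≢t₂

    closed : ∀ i {w} → w ∈N t i → ∃[ j ] t j ≡ w
    closed i {w} m = inN₀ (proj₂ (triangle-twins clique i w) m)

mainTheorem17 : (G : Graph) → Connected G → LidChromaticAtMost G 3 → IsTriangle G ⊎ Bipartite G
mainTheorem17 G conn (c , lidColouring) =
  [ inj₂ , fromMonochromaticEdge ]′ (bipartiteOrMonochromaticEdge fullness)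
  where
  open GraphFacts G
  open ThreeLidColouring G c lidColouring

  fromMonochromaticEdge : ∃₂ (λ u v → Adj G u v × fullness u ≡ fullness v) → IsTriangle G ⊎ Bipartite G
  fromMonochromaticEdge (u , v , uv , sameFullness) =
    Sum.map (λ (t , clique) → spanningClique⇒complete clique (triangle-spans conn clique))
            spannedByTwo⇒bipartite
            (twinEdge⇒triangleOrK₂ conn uv twins)
    where
    twins : SameClosedNbhd G u v
    twins = sameColours⇒twins uv (sameFullness⇒sameColours uv sameFullness)
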